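{- Let $P$ be a finite poset with an element $s\in P$ such that (i) for all $a\in P$, $a\vee s$ exists or $a\wedge s$ exists in $P$; and (ii) for all $a,b\in P$, if $a>b$, $a\vee s$ does not exist and $b\vee s$ does exist, then $a\wedge(b\vee s)$ exists in $P$. Then the order complex $\Delta(P)$ is non-evasive.
   Context: A simplicial complex is a down-set $\Sigma$ of a power set of a set (the empty set $\emptyset$ is allowed to be a member). Its vertex set is $V(\Sigma)=\{x\mid \{x\}\in\Sigma\}$. For $W\subseteq V$, $\Sigma|W=\{\sigma\in\Sigma\mid \sigma\subseteq W\}$. For $\sigma\in\Sigma$: $\mathrm{dl}_\Sigma(\sigma)=\Sigma|(V\setminus\sigma)$, $\mathrm{st}_\Sigma(\sigma)=\{\tau\in\Sigma\mid \sigma\cup\tau\in\Sigma\}$, $\mathrm{lk}_\Sigma(\sigma)=\mathrm{dl}_\Sigma(\sigma)\cap\mathrm{st}_\Sigma(\sigma)$; for a vertex $v$ write $\mathrm{dl}_\Sigma(v)$, $\mathrm{lk}_\Sigma(v)$ for $\sigma=\{v\}$. Non-evasiveness is defined by induction on $|V|$ (for $V$ finite): $\Sigma$ is non-evasive if for some $v\in V$, either $\Sigma=\{\emptyset,\{v\}\}$, or $|V|>1$ and both $\mathrm{dl}_\Sigma(v)$ and $\mathrm{lk}_\Sigma(v)$ are non-evasive. The order complex $\Delta(P)$ of a poset $P$ is the simplicial complex of all chains of $P$ (including $\emptyset$). -}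

module Defs where

open import Level using (0ℓ)
open import Data.Nat using (ℕ)
open import Data.Fin using (Fin)
open import Data.Fin.Subset using (Subset; _∈_; _∉_; ⁅_⁆; _∪_; _⊆_)
open import Data.Product using (Σ; ∃; ∃-syntax; _×_; _,_)
open import Data.Sum using (_⊎_)
open import Relation.Binary.PropositionalEquality using (_≡_; _≢_)
open import Relation.Nullary using (¬_)
open import Function.Bundles using (_⇔_)

Complex : ℕ → Set₁
Complex n = Subset n → Set

module _ {n : ℕ} where

  dl : Complex n → Fin n → Complex n
  dl K v σ = K σ × v ∉ σ

  st : Complex n → Fin n → Complex n
  st K v σ = K σ × K (σ ∪ ⁅ v ⁆)

  lk : Complex n → Fin n → Complex n
  lk K v σ = dl K v σ × st K v σ

  -- Non-evasiveness (inductive definition; derivations are finite, which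
  -- corresponds to the induction on |V|).  Vertex set V(Σ) = {x | {x} ∈ Σ}.
  data NonEvasive (K : Complex n) : Set where
    -- Σ = {∅, {v}}  (equality of complexes = extensional equality)
    point : (v : Fin n) → (∀ σ → K σ ⇔ (σ ⊆ ⁅ v ⁆)) → NonEvasive K
    -- v ∈ V, |V| > 1, dl and lk non-evasive
    step  : (v : Fin n) → K ⁅ v ⁆ → (∃[ w ] (w ≢ v × K ⁅ w ⁆)) →
            NonEvasive (dl K v) → NonEvasive (lk K v) → NonEvasive K

  OrderComplex : (Fin n → Fin n → Set) → Complex n
  OrderComplex _≤_ σ = ∀ x y → x ∈ σ → y ∈ σ → (x ≤ y) ⊎ (y ≤ x)

  module _ (_≤_ : Fin n → Fin n → Set) where
    IsJoin : Fin n → Fin n → Fin n → Set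
    IsJoin a b j = a ≤ j × b ≤ j × (∀ u → a ≤ u → b ≤ u → j ≤ u)

    IsMeet : Fin n → Fin n → Fin n → Set
    IsMeet a b m = m ≤ a × m ≤ b × (∀ u → u ≤ a → u ≤ b → u ≤ m)

    JoinExists : Fin n → Fin n → Set
    JoinExists a b = ∃[ j ] IsJoin a b j

    MeetExists : Fin n → Fin n → Set
    MeetExists a b = ∃[ m ] IsMeet a b m

-- Collapse Δ(P) one vertex at a time.  If a subposet Q carries a closure operator f whose
-- image has a least element c, then Δ(Q) is non-evasive: deleting a non-fixed point y keeps
-- f a closure, and the link of y is the join of the part below y with the part above y,
-- which is non-evasive since f again acts there with least value f y; once every point is
-- fixed, c is a cone point.  First the minimal elements a without a join a ∨ s are deleted:
-- below a, the map y ↦ a ∧ (y ∨ s) is such a closure with least value a ∧ s.  What remains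
-- consists of joinable elements, on which y ↦ y ∨ s is a closure with least value s.

module Submission where

open import Level using (0ℓ)
open import Data.Nat using (ℕ)
open import Data.Fin using (Fin; _≟_)
open import Data.Fin.Properties using (any?; all?)
open import Data.Fin.Subset using (Subset; _∈_; ⁅_⁆; _∪_; _⊆_; _⊂_; Lift)
open import Data.Fin.Subset.Properties using (x∈⁅x⁆; x∈⁅y⁆⇒x≡y; x∈p∪q⁺; x∈p∪q⁻)
open import Data.Fin.Subset.Induction using (⊂-wellFounded)
open import Data.Vec using (tabulate)
open import Data.Vec.Properties using (lookup∘tabulate; lookup⇒[]=; []=⇒lookup)
open import Data.Product using (∃-syntax; _×_; _,_; proj₁; proj₂; map; map₁)
open import Data.Sum using (_⊎_; inj₁; inj₂; swap; map₂)
open import Data.Unit using (⊤; tt)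
open import Function using (_∘_; id)
open import Function.Bundles using (_⇔_; mk⇔; Equivalence)
open import Induction.WellFounded using (WellFounded; Acc; acc; module Subrelation)
import Relation.Binary.Construct.On as On
open import Relation.Binary.PropositionalEquality using (_≡_; _≢_; refl; sym; trans; subst; cong)
open import Relation.Binary.Structures using (IsDecPartialOrder)
import Relation.Binary.Construct.NonStrictToStrict as NonStrictToStrict
open import Relation.Nullary using (¬_; Dec; yes; no; does)
open import Relation.Nullary.Decidable
  using (_×-dec_; _⊎-dec_; _→-dec_; ¬?; decidable-stable; dec-true)
open import Relation.Nullary.Negation using (contradiction)
open import Relation.Unary using (Pred; Decidable; _≐_)
open import Relation.Unary.Properties using (≐-refl; ≐-sym; ≐-trans)

open import Defs

open Equivalence using (to; from)

private
  variable
    n : ℕ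
    K L : Complex n
    v : Fin n
    σ : Subset n
    P : Pred (Fin n) 0ℓ

dl-resp : K ≐ L → dl K v ≐ dl L v
dl-resp (K⊆L , L⊆K) = map₁ K⊆L , map₁ L⊆K

lk-resp : K ≐ L → lk K v ≐ lk L v
lk-resp (K⊆L , L⊆K) = map (map₁ K⊆L) (map K⊆L K⊆L) , map (map₁ L⊆K) (map L⊆K L⊆K)

nonEvasive-resp : K ≐ L → NonEvasive K → NonEvasive L
nonEvasive-resp (K⊆L , L⊆K) (point v K≐⁅v⁆) =
  point v λ σ → mk⇔ (to (K≐⁅v⁆ σ) ∘ L⊆K) (K⊆L ∘ from (K≐⁅v⁆ σ))
nonEvasive-resp K≐L (step v Kv (w , w≢v , Kw) dl-ne lk-ne) =
  step v (proj₁ K≐L Kv) (w , w≢v , proj₁ K≐L Kw)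
    (nonEvasive-resp (dl-resp K≐L) dl-ne) (nonEvasive-resp (lk-resp K≐L) lk-ne)

∈-∪⁅⁆ : ∀ {x} → x ∈ σ ∪ ⁅ v ⁆ → x ∈ σ ⊎ x ≡ v
∈-∪⁅⁆ {σ = σ} {v} = map₂ (x∈⁅y⁆⇒x≡y v) ∘ x∈p∪q⁻ σ ⁅ v ⁆

Lift-⁅⁆ : P v → Lift P ⁅ v ⁆
Lift-⁅⁆ {v = v} Pv x∈⁅v⁆ with refl ← x∈⁅y⁆⇒x≡y v x∈⁅v⁆ = Pv

Lift-∪⁅⁆ : Lift P σ → P v → Lift P (σ ∪ ⁅ v ⁆)
Lift-∪⁅⁆ Pσ Pv x∈ with ∈-∪⁅⁆ x∈
... | inj₁ x∈σ = Pσ x∈σ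
... | inj₂ refl = Pv

record DecSubset (n : ℕ) : Set₁ where
  field
    mem  : Pred (Fin n) 0ℓ
    mem? : Decidable mem

open DecSubset

restrict : (S : DecSubset n) {P : Pred (Fin n) 0ℓ} → Decidable P → DecSubset n
mem  (restrict S {P} P?) x = mem S x × P x
mem? (restrict S P?) x     = mem? S x ×-dec P? x

_-_ : DecSubset n → Fin n → DecSubset n
S - v = restrict S (λ x → ¬? (x ≟ v))

_⊑_ : DecSubset n → DecSubset n → Set
R ⊑ S = ∀ {x} → mem R x → mem S x

record _⊏_ (R S : DecSubset n) : Set where
  constructor mk⊏
  field
    included : R ⊑ S
    missing  : ∃[ y ] (mem S y × ¬ mem R y)

restrict-⊏ : ∀ {S : DecSubset n} {P} {P? : Decidable P} {y} → mem S y → ¬ P y → restrict S P? ⊏ S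
restrict-⊏ Sy ¬Py = mk⊏ proj₁ (_ , Sy , ¬Py ∘ proj₂)

all-or-counterexample : (S : DecSubset n) {P : Pred (Fin n) 0ℓ} → Decidable P →
                        (∀ {x} → mem S x → P x) ⊎ ∃[ x ] (mem S x × ¬ P x)
all-or-counterexample S {P} P? with any? (λ x → mem? S x ×-dec ¬? (P? x))
... | yes counterexample = inj₂ counterexample
... | no none = inj₁ λ {x} Sx → decidable-stable (P? x) λ ¬Px → none (x , Sx , ¬Px)

toSubset : DecSubset n → Subset n
toSubset S = tabulate (does ∘ mem? S)

∈-toSubset⁺ : ∀ {S : DecSubset n} {x} → mem S x → x ∈ toSubset S
∈-toSubset⁺ {S = S} {x} Sx =
  lookup⇒[]= x (toSubset S) (trans (lookup∘tabulate (does ∘ mem? S) x) (dec-true (mem? S x) Sx))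

∈-toSubset⁻ : ∀ {S : DecSubset n} {x} → x ∈ toSubset S → mem S x
∈-toSubset⁻ {S = S} {x} x∈S
  with mem? S x | trans (sym (lookup∘tabulate (does ∘ mem? S) x)) ([]=⇒lookup x∈S)
... | yes Sx | _ = Sx
... | no _   | ()

⊏⇒⊂ : ∀ {R S : DecSubset n} → R ⊏ S → toSubset R ⊂ toSubset S
⊏⇒⊂ {R = R} {S} (mk⊏ R⊑S (y , Sy , ¬Ry)) =
    (λ x∈R → ∈-toSubset⁺ {S = S} (R⊑S (∈-toSubset⁻ {S = R} x∈R)))
  , y , ∈-toSubset⁺ {S = S} Sy , ¬Ry ∘ ∈-toSubset⁻ {S = R}

⊏-wellFounded : WellFounded (_⊏_ {n})
⊏-wellFounded = Subrelation.wellFounded ⊏⇒⊂ (On.wellFounded toSubset ⊂-wellFounded)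

module Subposets {_≤_ : Fin n → Fin n → Set} (isDecPartialOrder : IsDecPartialOrder _≡_ _≤_) where

  open IsDecPartialOrder isDecPartialOrder using (_≤?_; antisym; reflexive)
    renaming (refl to ≤-refl; trans to ≤-trans)
  open NonStrictToStrict _≡_ _≤_ using (_<_; <-irrefl; <⇒≤; <-decidable)

  _<?_ : ∀ x y → Dec (x < y)
  _<?_ = <-decidable _≟_ _≤?_

  <-≤-trans : ∀ {x y z} → x < y → y ≤ z → x < z
  <-≤-trans = NonStrictToStrict.<-≤-trans _≡_ _≤_ sym ≤-trans antisym λ { refl → id }

  Comparable : Fin n → Fin n → Set
  Comparable x y = x ≤ y ⊎ y ≤ x

  comparable? : ∀ x y → Dec (Comparable x y)
  comparable? x y = x ≤? y ⊎-dec y ≤? x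

  chain-⊆⁅⁆ : σ ⊆ ⁅ v ⁆ → OrderComplex _≤_ σ
  chain-⊆⁅⁆ {v = v} σ⊆⁅v⁆ x y x∈σ y∈σ =
    inj₁ (reflexive (trans (x∈⁅y⁆⇒x≡y v (σ⊆⁅v⁆ x∈σ)) (sym (x∈⁅y⁆⇒x≡y v (σ⊆⁅v⁆ y∈σ)))))

  chain-∪⁅⁆ : OrderComplex _≤_ σ → (∀ {x} → x ∈ σ → Comparable x v) → OrderComplex _≤_ (σ ∪ ⁅ v ⁆)
  chain-∪⁅⁆ chain comparable x y x∈ y∈ with ∈-∪⁅⁆ x∈ | ∈-∪⁅⁆ y∈
  ... | inj₁ x∈σ | inj₁ y∈σ = chain x y x∈σ y∈σ
  ... | inj₁ x∈σ | inj₂ refl = comparable x∈σ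
  ... | inj₂ refl | inj₁ y∈σ = swap (comparable y∈σ)
  ... | inj₂ refl | inj₂ refl = inj₁ ≤-refl

  record Δ (S : DecSubset n) (σ : Subset n) : Set where
    constructor mkΔ
    field
      within  : Lift (mem S) σ
      isChain : OrderComplex _≤_ σ

  link : DecSubset n → Fin n → DecSubset n
  link S v = restrict S (λ x → ¬? (x ≟ v) ×-dec comparable? x v)

  Δ-⁅⁆ : ∀ {S} → Δ S ⁅ v ⁆ ⇔ mem S v
  Δ-⁅⁆ {v = v} = mk⇔ (λ (mkΔ S⁅v⁆ _) → S⁅v⁆ (x∈⁅x⁆ v)) (λ Sv → mkΔ (Lift-⁅⁆ Sv) (chain-⊆⁅⁆ id))

  dl-Δ : ∀ {S} → dl (Δ S) v ≐ Δ (S - v)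
  dl-Δ {v = v} = (λ (mkΔ Sσ chain , v∉σ) → mkΔ (λ x∈σ → Sσ x∈σ , λ { refl → v∉σ x∈σ }) chain)
               , (λ (mkΔ S-vσ chain) →
                    mkΔ (λ x∈σ → proj₁ (S-vσ x∈σ)) chain , λ v∈σ → proj₂ (S-vσ v∈σ) refl)

  lk-Δ : ∀ {S} → mem S v → lk (Δ S) v ≐ Δ (link S v)
  lk-Δ {v = v} Sv =
    (λ ((mkΔ Sσ chain , v∉σ) , _ , mkΔ _ chain-v) →
       mkΔ (λ x∈σ → Sσ x∈σ , (λ { refl → v∉σ x∈σ })
                           , chain-v _ v (x∈p∪q⁺ (inj₁ x∈σ)) (x∈p∪q⁺ (inj₂ (x∈⁅x⁆ v))))
           chain)
    , (λ (mkΔ linkσ chain) →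
         let Δσ = mkΔ (λ x∈σ → proj₁ (linkσ x∈σ)) chain in
         (Δσ , λ v∈σ → proj₁ (proj₂ (linkσ v∈σ)) refl)
       , Δσ , mkΔ (Lift-∪⁅⁆ (Δ.within Δσ) Sv) (chain-∪⁅⁆ chain (λ x∈σ → proj₂ (proj₂ (linkσ x∈σ)))))

  nonEvasive-point : ∀ {S} → mem S v → (∀ {x} → mem S x → x ≡ v) → NonEvasive (Δ S)
  nonEvasive-point {v = v} {S} Sv S≡v = point v λ σ → mk⇔ ⊆⁅v⁆ (Δ-⊆⁅v⁆ σ)
    where
    ⊆⁅v⁆ : ∀ {σ} → Δ S σ → σ ⊆ ⁅ v ⁆
    ⊆⁅v⁆ (mkΔ Sσ _) x∈σ = subst (_∈ ⁅ v ⁆) (sym (S≡v (Sσ x∈σ))) (x∈⁅x⁆ v)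
    Δ-⊆⁅v⁆ : ∀ σ → σ ⊆ ⁅ v ⁆ → Δ S σ
    Δ-⊆⁅v⁆ σ σ⊆⁅v⁆ = mkΔ (λ x∈σ → Lift-⁅⁆ Sv (σ⊆⁅v⁆ x∈σ)) (chain-⊆⁅⁆ σ⊆⁅v⁆)

  nonEvasive-step : ∀ {S w} → mem S v → mem S w → w ≢ v →
                    NonEvasive (Δ (S - v)) → NonEvasive (Δ (link S v)) → NonEvasive (Δ S)
  nonEvasive-step Sv Sw w≢v dl-ne lk-ne =
    step _ (from Δ-⁅⁆ Sv) (_ , w≢v , from Δ-⁅⁆ Sw)
      (nonEvasive-resp (≐-sym dl-Δ) dl-ne) (nonEvasive-resp (≐-sym (lk-Δ Sv)) lk-ne)

  nonEvasive-cone : ∀ {Q c} → Acc _⊏_ Q → mem Q c → (∀ {y} → mem Q y → Comparable c y) →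
                    NonEvasive (Δ Q)
  nonEvasive-cone {Q = Q} {c} (acc rec) Qc c-cone with all-or-counterexample Q (_≟ c)
  ... | inj₁ Q≡c = nonEvasive-point Qc Q≡c
  ... | inj₂ (y , Qy , y≢c) = nonEvasive-step Qy Qc (y≢c ∘ sym)
    (nonEvasive-cone (rec (restrict-⊏ Qy λ y≢y → y≢y refl))
       (Qc , y≢c ∘ sym) (c-cone ∘ proj₁))
    (nonEvasive-cone (rec (restrict-⊏ Qy λ (y≢y , _) → y≢y refl))
       (Qc , y≢c ∘ sym , c-cone Qy) (c-cone ∘ proj₁))

  ComparableOutside : DecSubset n → DecSubset n → Set
  ComparableOutside R Q = ∀ {x y} → mem R x → mem Q y → ¬ mem R y → Comparable x y

  -- Δ Q is the join Δ R * Δ (Q ∖ R), and a collapse of Δ R is replayed inside Δ Q.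
  nonEvasive-join : ∀ {R Q} → NonEvasive (Δ R) → R ⊑ Q → ComparableOutside R Q → NonEvasive (Δ Q)
  nonEvasive-join ne = go ne ≐-refl
    where
    go : ∀ {K R Q} → NonEvasive K → K ≐ Δ R → R ⊑ Q → ComparableOutside R Q → NonEvasive (Δ Q)
    go {R = R} {Q} (point v K≐⁅v⁆) (K⊆ΔR , ΔR⊆K) R⊑Q comparable =
      nonEvasive-cone (⊏-wellFounded _) (R⊑Q Rv) v-cone
      where
      Rv : mem R v
      Rv = to Δ-⁅⁆ (K⊆ΔR (from (K≐⁅v⁆ ⁅ v ⁆) id))
      R≡v : ∀ {x} → mem R x → x ≡ v
      R≡v {x} Rx = x∈⁅y⁆⇒x≡y v (to (K≐⁅v⁆ ⁅ x ⁆) (ΔR⊆K (from Δ-⁅⁆ Rx)) (x∈⁅x⁆ x))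
      v-cone : ∀ {y} → mem Q y → Comparable v y
      v-cone {y} Qy with mem? R y
      ... | yes Ry = inj₁ (reflexive (sym (R≡v Ry)))
      ... | no ¬Ry = comparable Rv Qy ¬Ry
    go {R = R} (step v Kv (w , w≢v , Kw) dl-ne lk-ne) K≐ΔR R⊑Q comparable =
      nonEvasive-step (R⊑Q Rv) (R⊑Q (to Δ-⁅⁆ (proj₁ K≐ΔR Kw))) w≢v
        (go dl-ne (≐-trans (dl-resp K≐ΔR) dl-Δ) (map₁ R⊑Q)
           λ (Rx , _) (Qy , y≢v) ¬R-vy → comparable Rx Qy λ Ry → ¬R-vy (Ry , y≢v))
        (go lk-ne (≐-trans (lk-resp K≐ΔR) (lk-Δ Rv)) (map₁ R⊑Q)
           λ (Rx , _) (Qy , y∈link) ¬Rlink-y → comparable Rx Qy λ Ry → ¬Rlink-y (Ry , y∈link))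
      where
      Rv : mem R v
      Rv = to Δ-⁅⁆ (proj₁ K≐ΔR Kv)

  record IsClosure (Q : DecSubset n) (f : Fin n → Fin n) : Set where
    field
      closed     : ∀ {x} → mem Q x → mem Q (f x)
      extensive  : ∀ {x} → mem Q x → x ≤ f x
      monotone   : ∀ {x y} → mem Q x → mem Q y → x ≤ y → f x ≤ f y
      idempotent : ∀ {x} → mem Q x → f (f x) ≡ f x

  IsClosure-restrict : ∀ {R Q f} → R ⊑ Q → (∀ {x} → mem R x → mem R (f x)) →
                       IsClosure Q f → IsClosure R f
  IsClosure-restrict R⊑Q R-closed Q-closure = record
    { closed     = R-closed
    ; extensive  = extensive ∘ R⊑Q
    ; monotone   = λ Rx Ry → monotone (R⊑Q Rx) (R⊑Q Ry)
    ; idempotent = idempotent ∘ R⊑Q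
    }
    where open IsClosure Q-closure

  nonEvasive-closure : ∀ {Q f c} → Acc _⊏_ Q → IsClosure Q f → mem Q c → f c ≡ c →
                       (∀ {x} → mem Q x → c ≤ f x) → NonEvasive (Δ Q)
  nonEvasive-closure {Q = Q} {f} {c} (acc rec) isClosure Qc fc≡c c≤f
    with all-or-counterexample Q (λ y → f y ≟ y)
  ... | inj₁ fixed = nonEvasive-cone (acc rec) Qc λ Qy → inj₁ (subst (c ≤_) (fixed Qy) (c≤f Qy))
  ... | inj₂ (y , Qy , fy≢y) = nonEvasive-step Qy Qc c≢y
    (nonEvasive-closure (rec (restrict-⊏ Qy λ y≢y → y≢y refl))
       (IsClosure-restrict proj₁ (λ (Qx , x≢y) → closed Qx , f-avoids-y Qx) isClosure)
       (Qc , c≢y) fc≡c (c≤f ∘ proj₁))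
    (nonEvasive-join
       (nonEvasive-closure (rec (restrict-⊏ {P? = y <?_} Qy (<-irrefl refl)))
          (IsClosure-restrict proj₁ (λ (Qz , y<z) → closed Qz , <-≤-trans y<z (extensive Qz))
             isClosure)
          (closed Qy , extensive Qy , fy≢y ∘ sym) (idempotent Qy)
          λ (Qz , y<z) → monotone Qy Qz (<⇒≤ y<z))
       (λ (Qz , y<z) → Qz , (λ { refl → <-irrefl refl y<z }) , inj₂ (<⇒≤ y<z))
       below-y-comparable)
    where
    open IsClosure isClosure
    c≢y : c ≢ y
    c≢y refl = fy≢y fc≡c
    f-avoids-y : ∀ {x} → mem Q x → f x ≢ y
    f-avoids-y Qx fx≡y = fy≢y (trans (cong f (sym fx≡y)) (trans (idempotent Qx) fx≡y))
    below-y-comparable : ComparableOutside (restrict Q (y <?_)) (link Q y)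
    below-y-comparable (_ , y<x) (_ , _ , inj₁ z≤y) _ = inj₂ (≤-trans z≤y (<⇒≤ y<x))
    below-y-comparable _ (Qz , z≢y , inj₂ y≤z) ¬y<z = contradiction (Qz , y≤z , z≢y ∘ sym) ¬y<z

  minimal : ∀ {S a} → Acc _⊏_ S → mem S a → ∃[ m ] (mem S m × ∀ {b} → mem S b → ¬ b < m)
  minimal {S = S} {a} (acc rec) Sa with any? (λ b → mem? S b ×-dec b <? a)
  ... | no nothing-below = a , Sa , λ Sb b<a → nothing-below (_ , Sb , b<a)
  ... | yes (b , Sb , b<a)
    with minimal (rec (restrict-⊏ {P? = _<? a} Sa (<-irrefl refl))) (Sb , b<a)
  ...   | m , (Sm , m<a) , m-minimal =
          m , Sm , λ Sx x<m → m-minimal (Sx , <-≤-trans x<m (<⇒≤ m<a)) x<m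

  isJoin? : ∀ a b j → Dec (IsJoin _≤_ a b j)
  isJoin? a b j = a ≤? j ×-dec b ≤? j ×-dec all? λ u → a ≤? u →-dec b ≤? u →-dec j ≤? u

  isMeet? : ∀ a b m → Dec (IsMeet _≤_ a b m)
  isMeet? a b m = m ≤? a ×-dec m ≤? b ×-dec all? λ u → u ≤? a →-dec u ≤? b →-dec u ≤? m

  -- Chosen joins and meets; where none exists the junk value is the left argument.
  infixl 30 _∨_ _∧_

  _∨_ : Fin n → Fin n → Fin n
  a ∨ b with any? (isJoin? a b)
  ... | yes (j , _) = j
  ... | no _        = a

  _∧_ : Fin n → Fin n → Fin n
  a ∧ b with any? (isMeet? a b)
  ... | yes (m , _) = m
  ... | no _        = a

  ∨-isJoin : ∀ {a b} → JoinExists _≤_ a b → IsJoin _≤_ a b (a ∨ b)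
  ∨-isJoin {a} {b} join with any? (isJoin? a b)
  ... | yes (_ , isJoin) = isJoin
  ... | no no-join       = contradiction join no-join

  ∧-isMeet : ∀ {a b} → MeetExists _≤_ a b → IsMeet _≤_ a b (a ∧ b)
  ∧-isMeet {a} {b} meet with any? (isMeet? a b)
  ... | yes (_ , isMeet) = isMeet
  ... | no no-meet       = contradiction meet no-meet

  isJoin-unique : ∀ {a b j k} → IsJoin _≤_ a b j → IsJoin _≤_ a b k → j ≡ k
  isJoin-unique (a≤j , b≤j , j-least) (a≤k , b≤k , k-least) =
    antisym (j-least _ a≤k b≤k) (k-least _ a≤j b≤j)

  isJoin-≥ : ∀ {a b} → b ≤ a → IsJoin _≤_ a b a
  isJoin-≥ b≤a = ≤-refl , b≤a , λ _ a≤u _ → a≤u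

  isJoin-≤ : ∀ {a b} → a ≤ b → IsJoin _≤_ a b b
  isJoin-≤ a≤b = a≤b , ≤-refl , λ _ _ b≤u → b≤u

  isJoin-mono : ∀ {a b c j k} → IsJoin _≤_ a c j → IsJoin _≤_ b c k → a ≤ b → j ≤ k
  isJoin-mono (_ , _ , j-least) (b≤k , c≤k , _) a≤b = j-least _ (≤-trans a≤b b≤k) c≤k

  isJoin-squeeze : ∀ {a b j m} → IsJoin _≤_ a b j → a ≤ m → m ≤ j → IsJoin _≤_ m b j
  isJoin-squeeze (_ , b≤j , j-least) a≤m m≤j =
    m≤j , b≤j , λ u m≤u b≤u → j-least u (≤-trans a≤m m≤u) b≤u

  x≥y⇒x∨y≡x : ∀ {x y} → y ≤ x → x ∨ y ≡ x
  x≥y⇒x∨y≡x y≤x = isJoin-unique (∨-isJoin (_ , isJoin-≥ y≤x)) (isJoin-≥ y≤x)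

  x≤y⇒x∨y≡y : ∀ {x y} → x ≤ y → x ∨ y ≡ y
  x≤y⇒x∨y≡y x≤y = isJoin-unique (∨-isJoin (_ , isJoin-≤ x≤y)) (isJoin-≤ x≤y)

  module _ (s : Fin n)
           (join-or-meet : ∀ a → JoinExists _≤_ a s ⊎ MeetExists _≤_ a s)
           (meet-with-join : ∀ a b → b ≤ a → b ≢ a → ¬ JoinExists _≤_ a s →
                               ∀ j → IsJoin _≤_ b s j → MeetExists _≤_ a j)
    where

    Joinable : Pred (Fin n) 0ℓ
    Joinable x = JoinExists _≤_ x s

    joinable? : Decidable Joinable
    joinable? x = any? (isJoin? x s)

    s≤x∨s : ∀ {x} → Joinable x → s ≤ x ∨ s
    s≤x∨s = proj₁ ∘ proj₂ ∘ ∨-isJoin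

    joinable-≤s : ∀ {x} → x ≤ s → Joinable x
    joinable-≤s x≤s = s , isJoin-≤ x≤s

    joinable-s : Joinable s
    joinable-s = joinable-≤s ≤-refl

    ∨s-isClosure : ∀ {Q} → (∀ {x} → mem Q x → Joinable x) → (∀ {x} → Joinable x → mem Q x) →
                   IsClosure Q (_∨ s)
    ∨s-isClosure Q-joinable Q⊇joinable = record
      { closed     = λ Qx → Q⊇joinable (_ , isJoin-≥ (s≤x∨s (Q-joinable Qx)))
      ; extensive  = proj₁ ∘ ∨-isJoin ∘ Q-joinable
      ; monotone   = λ Qx Qy → isJoin-mono (∨-isJoin (Q-joinable Qx)) (∨-isJoin (Q-joinable Qy))
      ; idempotent = x≥y⇒x∨y≡x ∘ s≤x∨s ∘ Q-joinable
      }

    -- Hypothesis (ii) is exactly what makes y ↦ a ∧ (y ∨ s) defined below a.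
    module BelowNonJoinable {Q a} (¬joinable-a : ¬ Joinable a)
                            (Q⊇joinable : ∀ {x} → Joinable x → mem Q x)
                            (below-joinable : ∀ {y} → mem Q y → y < a → Joinable y) where

      Below : DecSubset n
      Below = restrict Q (_<? a)

      g : Fin n → Fin n
      g y = a ∧ (y ∨ s)

      joinable⇒≢a : ∀ {x} → Joinable x → x ≢ a
      joinable⇒≢a Jx refl = ¬joinable-a Jx

      isJoin-∨s : ∀ {y} → mem Below y → IsJoin _≤_ y s (y ∨ s)
      isJoin-∨s (Qy , y<a) = ∨-isJoin (below-joinable Qy y<a)

      isMeet-g : ∀ {y} → mem Below y → IsMeet _≤_ a (y ∨ s) (g y)
      isMeet-g By@(_ , y≤a , y≢a) =
        ∧-isMeet (meet-with-join _ _ y≤a y≢a ¬joinable-a _ (isJoin-∨s By))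

      y≤gy : ∀ {y} → mem Below y → y ≤ g y
      y≤gy By@(_ , y≤a , _) = proj₂ (proj₂ (isMeet-g By)) _ y≤a (proj₁ (isJoin-∨s By))

      isJoin-gy : ∀ {y} → mem Below y → IsJoin _≤_ (g y) s (y ∨ s)
      isJoin-gy By = isJoin-squeeze (isJoin-∨s By) (y≤gy By) (proj₁ (proj₂ (isMeet-g By)))

      g-isClosure : IsClosure Below g
      g-isClosure = record
        { closed     = λ By → let Jgy = _ , isJoin-gy By in
                              Q⊇joinable Jgy , proj₁ (isMeet-g By) , joinable⇒≢a Jgy
        ; extensive  = y≤gy
        ; monotone   = λ Bx By x≤y → let (gx≤a , gx≤x∨s , _) = isMeet-g Bx in
            proj₂ (proj₂ (isMeet-g By)) _ gx≤a
              (≤-trans gx≤x∨s (isJoin-mono (isJoin-∨s Bx) (isJoin-∨s By) x≤y))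
        ; idempotent = λ By →
            cong (a ∧_) (isJoin-unique (∨-isJoin (_ , isJoin-gy By)) (isJoin-gy By))
        }

      isMeet-as : IsMeet _≤_ a s (a ∧ s)
      isMeet-as with join-or-meet a
      ... | inj₁ joinable-a = contradiction joinable-a ¬joinable-a
      ... | inj₂ meet       = ∧-isMeet meet

      as≤s : a ∧ s ≤ s
      as≤s = proj₁ (proj₂ isMeet-as)

      as∈Below : mem Below (a ∧ s)
      as∈Below = Q⊇joinable (joinable-≤s as≤s) , proj₁ isMeet-as , joinable⇒≢a (joinable-≤s as≤s)

      g-as≡as : g (a ∧ s) ≡ a ∧ s
      g-as≡as = cong (a ∧_) (x≤y⇒x∨y≡y as≤s)

      as≤g : ∀ {y} → mem Below y → a ∧ s ≤ g y
      as≤g By =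
        proj₂ (proj₂ (isMeet-g By)) _ (proj₁ isMeet-as) (≤-trans as≤s (proj₁ (proj₂ (isJoin-∨s By))))

      above-a-comparable : ComparableOutside Below (link Q a)
      above-a-comparable _ (Qz , z≢a , inj₁ z≤a) ¬z<a = contradiction (Qz , z≤a , z≢a) ¬z<a
      above-a-comparable (_ , x<a) (_ , _ , inj₂ a≤z) _ = inj₁ (≤-trans (<⇒≤ x<a) a≤z)

      nonEvasive-link : NonEvasive (Δ (link Q a))
      nonEvasive-link = nonEvasive-join
        (nonEvasive-closure (⊏-wellFounded Below) g-isClosure as∈Below g-as≡as as≤g)
        (λ (Qy , y≤a , y≢a) → Qy , y≢a , inj₁ y≤a)
        above-a-comparable

    nonEvasive-⊇joinable : ∀ {Q} → Acc _⊏_ Q → (∀ {x} → Joinable x → mem Q x) → NonEvasive (Δ Q)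
    nonEvasive-⊇joinable {Q} (acc rec) Q⊇joinable with all-or-counterexample Q joinable?
    ... | inj₁ Q-joinable =
      nonEvasive-closure (acc rec) (∨s-isClosure Q-joinable Q⊇joinable) (Q⊇joinable joinable-s)
        (x≥y⇒x∨y≡x ≤-refl) (s≤x∨s ∘ Q-joinable)
    ... | inj₂ (a₀ , Qa₀ , ¬joinable-a₀)
      with minimal (⊏-wellFounded (restrict Q (¬? ∘ joinable?))) (Qa₀ , ¬joinable-a₀)
    ... | a , (Qa , ¬joinable-a) , a-minimal =
      nonEvasive-step Qa (Q⊇joinable joinable-s) (joinable⇒≢a joinable-s)
        (nonEvasive-⊇joinable (rec (restrict-⊏ Qa λ a≢a → a≢a refl))
           λ Jx → Q⊇joinable Jx , joinable⇒≢a Jx)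
        nonEvasive-link
      where
      below-joinable : ∀ {y} → mem Q y → y < a → Joinable y
      below-joinable {y} Qy y<a = decidable-stable (joinable? y) λ ¬Jy → a-minimal (Qy , ¬Jy) y<a
      open BelowNonJoinable {Q = Q} ¬joinable-a Q⊇joinable below-joinable

full : DecSubset n
full = record { mem = λ _ → ⊤ ; mem? = λ _ → yes tt }

theorem14 : (n : ℕ) (_≤_ : Fin n → Fin n → Set) →
            IsDecPartialOrder _≡_ _≤_ →
            (s : Fin n) →
            (∀ a → JoinExists _≤_ a s ⊎ MeetExists _≤_ a s) →
            (∀ a b → b ≤ a → b ≢ a → ¬ JoinExists _≤_ a s →
               ∀ j → IsJoin _≤_ b s j → MeetExists _≤_ a j) →
            NonEvasive (OrderComplex _≤_)
theorem14 n _≤_ isDecPartialOrder s join-or-meet meet-with-join =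
  nonEvasive-resp (Δ.isChain , mkΔ (λ _ → tt))
    (nonEvasive-⊇joinable s join-or-meet meet-with-join (⊏-wellFounded full) λ _ → tt)
  where open Subposets isDecPartialOrder
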